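{- (a) Let $G$ be an $n$-vertex graph with $\delta(G)\ge n/2+1$, or a balanced bipartite graph on $2n$ vertices with $\delta(G)\ge\lfloor (n+3)/2\rfloor$. Then for every perfect matching $M$ of $G$ and every edge $e\in M$ there exists a perfect matching $M'$ of $G$ with $|M\,\Delta\,M'|=4$ and $e\notin M'$ (a $2$-switch containing $e$). (b) For every even $n$ there is an $n$-vertex graph $G$ with $\delta(G)\ge n/2-2$ such that $\mathcal H_2(G)$ has an isolated vertex, and for every $n$ there is a balanced bipartite graph $G$ on $2n$ vertices with $\delta(G)\ge \lfloor (n+1)/2\rfloor$ such that $\mathcal H_2(G)$ has an isolated vertex. In other words, $\frac n2-1\le \delta^{\mathrm{noiso}}_2(n)\le \frac n2+1$ for even $n$, and $\delta^{\mathrm{noiso}}_{2,\mathrm{bip}}(n)=\lfloor (n+3)/2\rfloor$.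
   Context: For a graph $G$, the $2$-switch graph $\mathcal H_2(G)$ is the graph whose vertex set is the set of perfect matchings of $G$, two distinct perfect matchings $M_1,M_2$ being adjacent iff $|M_1\,\Delta\,M_2|\le 4$. $\delta^{\mathrm{noiso}}_2(n)$ is the least integer $\delta$ such that for every $n$-vertex graph $G$ with minimum degree at least $\delta$, $\mathcal H_2(G)$ has no isolated vertex (the graph with no vertices counts as having no isolated vertex); $\delta^{\mathrm{noiso}}_{2,\mathrm{bip}}(n)$ is defined in the same way with $G$ ranging over balanced bipartite graphs on $2n$ vertices. -}

module Defs where

open import Data.Nat using (ℕ; zero; suc; _+_; _*_; _≤_; _<_; _<ᵇ_)
open import Data.Fin using (Fin; toℕ) renaming (zero to fz; suc to fs)
open import Data.Bool using (Bool; true; false; if_then_else_; _∧_; _xor_)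
open import Data.Product using (Σ; _×_; ∃; ∃-syntax)
open import Relation.Binary.PropositionalEquality using (_≡_; _≢_)

∑ : ∀ {n} → (Fin n → ℕ) → ℕ
∑ {zero}  f = 0
∑ {suc n} f = f fz + ∑ (λ i → f (fs i))

count : ∀ {n} → (Fin n → Bool) → ℕ
count p = ∑ (λ i → if p i then 1 else 0)

record Graph (n : ℕ) : Set where
  field
    Adj   : Fin n → Fin n → Bool
    sym   : ∀ i j → Adj i j ≡ Adj j i
    irrfl : ∀ i → Adj i i ≡ false
open Graph public

degree : ∀ {n} → Graph n → Fin n → ℕ
degree G v = count (Adj G v)

MinDegGE : ∀ {n} → Graph n → ℕ → Set
MinDegGE G d = ∀ v → d ≤ degree G v

-- An edge set on Fin n is a symmetric Boolean matrix;
-- the edge {i,j} belongs to S iff S i j ≡ true.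
EdgeSet : ℕ → Set
EdgeSet n = Fin n → Fin n → Bool

edgeCount : ∀ {n} → EdgeSet n → ℕ
edgeCount S = ∑ (λ i → count (λ j → (toℕ i <ᵇ toℕ j) ∧ S i j))

_Δ_ : ∀ {n} → EdgeSet n → EdgeSet n → EdgeSet n
(S Δ T) i j = S i j xor T i j

IsPerfectMatching : ∀ {n} → Graph n → EdgeSet n → Set
IsPerfectMatching G M =
  (∀ i j → M i j ≡ true → Adj G i j ≡ true) ×
  (∀ i j → M i j ≡ M j i) ×
  (∀ i → count (M i) ≡ 1)

Distinct : ∀ {n} → EdgeSet n → EdgeSet n → Set
Distinct M M' = ∃[ i ] ∃[ j ] (M i j ≢ M' i j)

IsolatedInH2 : ∀ {n} → Graph n → EdgeSet n → Set
IsolatedInH2 G M =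
  IsPerfectMatching G M ×
  (∀ M' → IsPerfectMatching G M' → Distinct M M' → 4 < edgeCount (M Δ M'))

-- Balanced bipartite graphs on 2n vertices, given by their biadjacency
-- relation between the parts L = Fin n and R = Fin n.

BipGraph : ℕ → Set
BipGraph n = Fin n → Fin n → Bool

BipMinDegGE : ∀ {n} → BipGraph n → ℕ → Set
BipMinDegGE G d = (∀ i → d ≤ count (G i)) × (∀ j → d ≤ count (λ i → G i j))

BipEdgeSet : ℕ → Set
BipEdgeSet n = Fin n → Fin n → Bool

bipEdgeCount : ∀ {n} → BipEdgeSet n → ℕ
bipEdgeCount S = ∑ (λ i → count (S i))

_Δᵇ_ : ∀ {n} → BipEdgeSet n → BipEdgeSet n → BipEdgeSet n
(S Δᵇ T) i j = S i j xor T i j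

IsBipPerfectMatching : ∀ {n} → BipGraph n → BipEdgeSet n → Set
IsBipPerfectMatching G M =
  (∀ i j → M i j ≡ true → G i j ≡ true) ×
  (∀ i → count (M i) ≡ 1) ×
  (∀ j → count (λ i → M i j) ≡ 1)

BipDistinct : ∀ {n} → BipEdgeSet n → BipEdgeSet n → Set
BipDistinct M M' = ∃[ i ] ∃[ j ] (M i j ≢ M' i j)

BipIsolatedInH2 : ∀ {n} → BipGraph n → BipEdgeSet n → Set
BipIsolatedInH2 G M =
  IsBipPerfectMatching G M ×
  (∀ M' → IsBipPerfectMatching G M' → BipDistinct M M' → 4 < bipEdgeCount (M Δᵇ M'))

{-# OPTIONS --safe #-}
module Submission where

-- Store a perfect matching by its partner map μ: an involution of the vertex set, or a
-- bijection between the two sides when G is bipartite.  Then |M Δ M'| only depends on the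
-- vertices whose partner changes.
--
-- (a) Let v = μ u.  Since deg u + deg v ≥ n + 2, the neighbourhood of u and the preimage
-- under μ of the neighbourhood of v share two vertices, so some x ≠ v has u ~ x and
-- v ~ μ x.  Replacing the edges uv and x(μ x) by ux and v(μ x) is a 2-switch avoiding uv.
--
-- (b) If G has no alternating 4-cycle for M, any other perfect matching changes the
-- partners of at least five vertices (of at least three rows in the bipartite case), so M
-- is isolated in H₂.  Both examples are built from parities, and their degrees are counts
-- of alternating Boolean sequences.

open import Defs hiding (sym)

open import Data.Bool.Base using (Bool; true; false; not; _∧_; _xor_; if_then_else_)
open import Data.Bool.Properties
  using (xor-same; xor-comm; ¬-not; ∧-zeroʳ; not-involutive; not-distribˡ-xor; not-distribʳ-xor)
import Data.Bool.Properties as Bool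
open import Data.Empty using (⊥; ⊥-elim)
open import Data.Fin.Base using (Fin; zero; suc; toℕ)
open import Data.Fin.Properties using (_≟_; any?; toℕ-injective; toℕ<n)
open import Data.Fin.Permutation
  using (Permutation; permutation; _⟨$⟩ʳ_; _⟨$⟩ˡ_; inverseˡ; inverseʳ; _∘ₚ_)
import Data.Fin.Permutation as Perm
open import Data.Fin.Permutation.Components using (transpose; transpose-inverse)
open import Data.List.Base using (List; []; _∷_; length)
open import Data.List.Membership.Propositional using (_∈_; _∉_)
open import Data.List.Relation.Unary.All using (All; []; _∷_)
import Data.List.Relation.Unary.All as All
open import Data.List.Relation.Unary.All.Properties using (All¬⇒¬Any)
open import Data.List.Relation.Unary.Any using (here; there)
import Data.List.Relation.Unary.Any as Any
open import Data.List.Relation.Unary.Unique.Propositional using (Unique; []; _∷_)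
open import Data.Nat.Base
  using (ℕ; zero; suc; pred; _+_; _*_; _∸_; _≤_; _<_; _≤ᵇ_; _<ᵇ_; _/_; _%_; z≤n; s≤s)
open import Data.Nat.DivMod using (m≡m%n+[m/n]*n; m%n<n; m<n*o⇒m/o<n)
open import Data.Nat.Divisibility using (_∣_; divides)
open import Data.Nat.Properties hiding (_≟_)
import Algebra.Properties.Semiring.Sum +-*-semiring as ℕ-Sum
open import Data.Product using (Σ-syntax; ∃-syntax; _×_; _,_; proj₁; proj₂; map₁; map₂; swap)
open import Data.Sum using (_⊎_; inj₁; inj₂)
open import Function.Base using (_∘_)
open import Function.Bundles using (mk⇔)
open import Relation.Binary.Definitions using (tri<; tri≈; tri>)
open import Relation.Binary.PropositionalEquality
open import Relation.Nullary using (does; yes; no; ¬?; _×-dec_)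
open import Relation.Nullary.Decidable using (dec-true; dec-false; decidable-stable; does-⇔)
open import Relation.Nullary.Negation using (contradiction)

-- Sums and counts over Fin

⟦_⟧ : Bool → ℕ
⟦ b ⟧ = if b then 1 else 0

⟦⟧≤1 : ∀ b → ⟦ b ⟧ ≤ 1
⟦⟧≤1 true  = s≤s z≤n
⟦⟧≤1 false = z≤n

∑≡sum : ∀ {n} (f : Fin n → ℕ) → ∑ f ≡ ℕ-Sum.sum f
∑≡sum {zero}  f = refl
∑≡sum {suc n} f = cong (f zero +_) (∑≡sum (f ∘ suc))

∑-cong : ∀ {n} {f g : Fin n → ℕ} → (∀ i → f i ≡ g i) → ∑ f ≡ ∑ g
∑-cong {zero}  f≗g = refl
∑-cong {suc n} f≗g = cong₂ _+_ (f≗g zero) (∑-cong (f≗g ∘ suc))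

∑-mono-≤ : ∀ {n} {f g : Fin n → ℕ} → (∀ i → f i ≤ g i) → ∑ f ≤ ∑ g
∑-mono-≤ {zero}  f≤g = z≤n
∑-mono-≤ {suc n} f≤g = +-mono-≤ (f≤g zero) (∑-mono-≤ (f≤g ∘ suc))

∑-distrib-+ : ∀ {n} (f g : Fin n → ℕ) → ∑ (λ i → f i + g i) ≡ ∑ f + ∑ g
∑-distrib-+ f g = begin
  ∑ (λ i → f i + g i)         ≡⟨ ∑≡sum (λ i → f i + g i) ⟩
  ℕ-Sum.sum (λ i → f i + g i) ≡⟨ ℕ-Sum.∑-distrib-+ f g ⟩
  ℕ-Sum.sum f + ℕ-Sum.sum g   ≡⟨ cong₂ _+_ (∑≡sum f) (∑≡sum g) ⟨
  ∑ f + ∑ g                   ∎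
  where open ≡-Reasoning

∑-*ˡ : ∀ {n} c (f : Fin n → ℕ) → ∑ (λ i → c * f i) ≡ c * ∑ f
∑-*ˡ {zero}  c f = sym (*-zeroʳ c)
∑-*ˡ {suc n} c f = trans (cong (c * f zero +_) (∑-*ˡ c (f ∘ suc))) (sym (*-distribˡ-+ c (f zero) _))

∑-comm : ∀ {m n} (f : Fin m → Fin n → ℕ) → ∑ (λ i → ∑ (f i)) ≡ ∑ (λ j → ∑ (λ i → f i j))
∑-comm {m} {n} f = begin
  ∑ (λ i → ∑ (f i))                         ≡⟨ trans (∑≡sum (∑ ∘ f)) (ℕ-Sum.sum-cong-≗ (∑≡sum ∘ f)) ⟩
  ℕ-Sum.sum (λ i → ℕ-Sum.sum (f i))         ≡⟨ ℕ-Sum.∑-comm f ⟩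
  ℕ-Sum.sum (λ j → ℕ-Sum.sum (λ i → f i j)) ≡⟨ trans (∑≡sum (∑ ∘ fᵀ)) (ℕ-Sum.sum-cong-≗ (∑≡sum ∘ fᵀ)) ⟨
  ∑ (λ j → ∑ (λ i → f i j))                 ∎
  where
  open ≡-Reasoning
  fᵀ : Fin n → Fin m → ℕ
  fᵀ j i = f i j

∑-permute : ∀ {n} (f : Fin n → ℕ) (π : Permutation n n) → ∑ (λ i → f (π ⟨$⟩ʳ i)) ≡ ∑ f
∑-permute f π = begin
  ∑ (λ i → f (π ⟨$⟩ʳ i))         ≡⟨ ∑≡sum (λ i → f (π ⟨$⟩ʳ i)) ⟩
  ℕ-Sum.sum (λ i → f (π ⟨$⟩ʳ i)) ≡⟨ ℕ-Sum.sum-permute f π ⟨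
  ℕ-Sum.sum f                    ≡⟨ ∑≡sum f ⟨
  ∑ f                            ∎
  where open ≡-Reasoning

count-cong : ∀ {n} {p q : Fin n → Bool} → (∀ i → p i ≡ q i) → count p ≡ count q
count-cong p≗q = ∑-cong (cong ⟦_⟧ ∘ p≗q)

count-mono : ∀ {n} {p q : Fin n → Bool} → (∀ i → p i ≡ true → q i ≡ true) → count p ≤ count q
count-mono p⇒q = ∑-mono-≤ (λ i → ⟦⟧-mono (p⇒q i))
  where
  ⟦⟧-mono : ∀ {a b} → (a ≡ true → b ≡ true) → ⟦ a ⟧ ≤ ⟦ b ⟧
  ⟦⟧-mono {false} _   = z≤n
  ⟦⟧-mono {true}  a⇒b rewrite a⇒b refl = ≤-refl

count-false : ∀ n → count {n} (λ _ → false) ≡ 0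
count-false zero    = refl
count-false (suc n) = count-false n

count-true : ∀ n → count {n} (λ _ → true) ≡ n
count-true zero    = refl
count-true (suc n) = cong suc (count-true n)

count-singleton : ∀ {n} (a : Fin n) → count (λ j → does (j ≟ a)) ≡ 1
count-singleton {suc n} zero    = cong suc (count-false n)
count-singleton {suc n} (suc a) = count-singleton a

_∈ᵇ_ : ∀ {n} → Fin n → List (Fin n) → Bool
i ∈ᵇ l = does (Any.any? (i ≟_) l)

∈ᵇ-true : ∀ {n} {i : Fin n} {l} → i ∈ᵇ l ≡ true → i ∈ l
∈ᵇ-true {i = i} {l} e with Any.any? (i ≟_) l
∈ᵇ-true e  | yes i∈l = i∈l
∈ᵇ-true () | no _

count-∈ᵇ : ∀ {n} {l : List (Fin n)} → Unique l → count (_∈ᵇ l) ≡ length l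
count-∈ᵇ {n} [] = count-false n
count-∈ᵇ {l = a ∷ l} (a∉l ∷ u) = begin
  count (_∈ᵇ (a ∷ l))                        ≡⟨ ∑-cong split ⟩
  ∑ (λ i → ⟦ does (i ≟ a) ⟧ + ⟦ i ∈ᵇ l ⟧)    ≡⟨ ∑-distrib-+ (λ i → ⟦ does (i ≟ a) ⟧) (λ i → ⟦ i ∈ᵇ l ⟧) ⟩
  count (λ i → does (i ≟ a)) + count (_∈ᵇ l) ≡⟨ cong₂ _+_ (count-singleton a) (count-∈ᵇ u) ⟩
  suc (length l)                             ∎
  where
  open ≡-Reasoning
  split : ∀ i → ⟦ i ∈ᵇ (a ∷ l) ⟧ ≡ ⟦ does (i ≟ a) ⟧ + ⟦ i ∈ᵇ l ⟧
  split i with i ≟ a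
  ... | yes refl = cong (λ b → suc ⟦ b ⟧) (sym (dec-false (Any.any? (i ≟_) l) (All¬⇒¬Any a∉l)))
  ... | no _     = refl

length≤count : ∀ {n} {p : Fin n → Bool} {l} → Unique l → All (λ i → p i ≡ true) l →
               length l ≤ count p
length≤count {p = p} {l} u ps =
  subst (_≤ count p) (count-∈ᵇ u) (count-mono {p = _∈ᵇ l} (λ i → All.lookup ps ∘ ∈ᵇ-true))

count≡length : ∀ {n} {p : Fin n → Bool} {l} → Unique l → All (λ i → p i ≡ true) l →
               (∀ i → i ∉ l → p i ≡ false) → count p ≡ length l
count≡length {p = p} {l} u ps outside = trans (count-cong p≗∈ᵇ) (count-∈ᵇ u)
  where
  p≗∈ᵇ : ∀ i → p i ≡ i ∈ᵇ l
  p≗∈ᵇ i with Any.any? (i ≟_) l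
  ... | yes i∈l = All.lookup ps i∈l
  ... | no  i∉l = outside i i∉l

count≡1⇒unique : ∀ {n} {p : Fin n → Bool} {a b} → count p ≡ 1 → p a ≡ true → p b ≡ true → a ≡ b
count≡1⇒unique {a = a} {b} c≡1 pa pb with a ≟ b
... | yes a≡b = a≡b
... | no  a≢b = contradiction (subst (2 ≤_) c≡1 (length≤count ((a≢b ∷ []) ∷ [] ∷ []) (pa ∷ pb ∷ [])))
                             λ { (s≤s ()) }

count≡1⇒singleton : ∀ {n} {p : Fin n → Bool} → count p ≡ 1 → ∃[ a ] (∀ j → p j ≡ does (j ≟ a))
count≡1⇒singleton {p = p} c≡1 with any? (λ j → p j Bool.≟ true)
... | yes (a , pa) = a , characterise
  where
  characterise : ∀ j → p j ≡ does (j ≟ a)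
  characterise j with p j in pj
  ... | true  = sym (dec-true (j ≟ a) (count≡1⇒unique c≡1 pj pa))
  ... | false = sym (dec-false (j ≟ a) λ { refl → contradiction (trans (sym pa) pj) λ () })
... | no none = contradiction (trans (sym c≡1) (count≡length [] [] λ i _ → ¬-not (none ∘ (i ,_)))) λ ()

2≤count⇒∃≢ : ∀ {n} {p : Fin n → Bool} → 2 ≤ count p → ∀ v → ∃[ x ] (x ≢ v × p x ≡ true)
2≤count⇒∃≢ {p = p} 2≤c v with any? (λ x → ¬? (x ≟ v) ×-dec (p x Bool.≟ true))
... | yes found = found
... | no  none  = contradiction (≤-trans 2≤c (subst (count p ≤_) (count-singleton v) (count-mono {p = p} only-v)))
                               λ { (s≤s ()) }
  where
  only-v : ∀ x → p x ≡ true → does (x ≟ v) ≡ true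
  only-v x px = dec-true (x ≟ v) (decidable-stable (x ≟ v) λ x≢v → none (x , x≢v , px))

∧-true : ∀ {a b} → a ∧ b ≡ true → a ≡ true × b ≡ true
∧-true {true}  {true}  _  = refl , refl
∧-true {true}  {false} ()
∧-true {false}         ()

count-∧ : ∀ {n k} (p q : Fin n → Bool) → n + k ≤ count p + count q → k ≤ count (λ i → p i ∧ q i)
count-∧ {n} {k} p q n+k≤ = +-cancelˡ-≤ n k _ (begin
  n + k                          ≤⟨ n+k≤ ⟩
  count p + count q              ≡⟨ ∑-distrib-+ (⟦_⟧ ∘ p) (⟦_⟧ ∘ q) ⟨
  ∑ (λ i → ⟦ p i ⟧ + ⟦ q i ⟧)    ≤⟨ ∑-mono-≤ (λ i → inclusion–exclusion (p i) (q i)) ⟩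
  ∑ (λ i → 1 + ⟦ p i ∧ q i ⟧)    ≡⟨ ∑-distrib-+ {n} (λ _ → 1) (⟦_⟧ ∘ p∧q) ⟩
  count {n} (λ _ → true) + count p∧q ≡⟨ cong (_+ count p∧q) (count-true n) ⟩
  n + count p∧q                  ∎)
  where
  open ≤-Reasoning
  p∧q : Fin n → Bool
  p∧q i = p i ∧ q i
  inclusion–exclusion : ∀ a b → ⟦ a ⟧ + ⟦ b ⟧ ≤ 1 + ⟦ a ∧ b ⟧
  inclusion–exclusion true  true  = ≤-refl
  inclusion–exclusion true  false = ≤-refl
  inclusion–exclusion false b     = ⟦⟧≤1 b

edgeCount-cong : ∀ {n} {S T : EdgeSet n} → (∀ i → S i ≗ T i) → edgeCount S ≡ edgeCount T
edgeCount-cong S≗T = ∑-cong λ i → count-cong λ j → cong (_ ∧_) (S≗T i j)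

bipEdgeCount-cong : ∀ {n} {S T : BipEdgeSet n} → (∀ i → S i ≗ T i) → bipEdgeCount S ≡ bipEdgeCount T
bipEdgeCount-cong S≗T = ∑-cong λ i → count-cong (S≗T i)

edgeCount-double : ∀ {n} (S : EdgeSet n) → (∀ i j → S i j ≡ S j i) → (∀ i → S i i ≡ false) →
                   2 * edgeCount S ≡ ∑ (λ i → count (S i))
edgeCount-double {n} S symmetric irreflexive = begin
  2 * edgeCount S                           ≡⟨ cong (edgeCount S +_) (+-identityʳ _) ⟩
  edgeCount S + edgeCount S                 ≡⟨ cong (edgeCount S +_) lower≡upper ⟩
  edgeCount S + ∑ (λ i → ∑ (below i))       ≡⟨ ∑-distrib-+ (∑ ∘ above) (∑ ∘ below) ⟨
  ∑ (λ i → ∑ (above i) + ∑ (below i))       ≡⟨ ∑-cong (λ i → ∑-distrib-+ (above i) (below i)) ⟨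
  ∑ (λ i → ∑ (λ j → above i j + below i j)) ≡⟨ ∑-cong (λ i → ∑-cong (λ j → sym (split i j))) ⟩
  ∑ (λ i → count (S i))                     ∎
  where
  open ≡-Reasoning
  above below : Fin n → Fin n → ℕ
  above i j = ⟦ (toℕ i <ᵇ toℕ j) ∧ S i j ⟧
  below i j = ⟦ (toℕ j <ᵇ toℕ i) ∧ S i j ⟧

  lower≡upper : edgeCount S ≡ ∑ (λ i → ∑ (below i))
  lower≡upper = trans (∑-cong λ i → ∑-cong λ j → cong (λ b → ⟦ (toℕ i <ᵇ toℕ j) ∧ b ⟧) (symmetric i j))
                      (∑-comm (λ i j → below j i))

  split : ∀ i j → ⟦ S i j ⟧ ≡ above i j + below i j
  split i j with <-cmp (toℕ i) (toℕ j)
  ... | tri< i<j _ j≮i rewrite dec-true (toℕ i <? toℕ j) i<j | dec-false (toℕ j <? toℕ i) j≮i =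
    sym (+-identityʳ _)
  ... | tri> i≮j _ j<i rewrite dec-false (toℕ i <? toℕ j) i≮j | dec-true (toℕ j <? toℕ i) j<i = refl
  ... | tri≈ _ i≡j _ rewrite toℕ-injective i≡j | irreflexive j | ∧-zeroʳ (toℕ j <ᵇ toℕ j) = refl

-- Perfect matchings as partner maps

edgesOf : ∀ {n} → (Fin n → Fin n) → Fin n → Fin n → Bool
edgesOf μ i j = does (j ≟ μ i)

edgesOf⇒≡ : ∀ {n} {μ : Fin n → Fin n} {i j} → edgesOf μ i j ≡ true → j ≡ μ i
edgesOf⇒≡ {μ = μ} {i} {j} e  with j ≟ μ i
edgesOf⇒≡                 e  | yes j≡μi = j≡μi
edgesOf⇒≡                 () | no  _

disagreements : ∀ {n} → (Fin n → Fin n) → (Fin n → Fin n) → ℕ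
disagreements μ ν = count (λ i → not (does (μ i ≟ ν i)))

differs : ∀ {n} {a b : Fin n} → a ≢ b → not (does (a ≟ b)) ≡ true
differs {a = a} {b} a≢b = cong not (dec-false (a ≟ b) a≢b)

agrees : ∀ {n} {a b : Fin n} → a ≡ b → not (does (a ≟ b)) ≡ false
agrees {a = a} {b} a≡b = cong not (dec-true (a ≟ b) a≡b)

count-edgesOf-Δ-row : ∀ {n} (μ ν : Fin n → Fin n) i →
  count (λ j → edgesOf μ i j xor edgesOf ν i j) ≡ 2 * ⟦ not (does (μ i ≟ ν i)) ⟧
count-edgesOf-Δ-row μ ν i with μ i ≟ ν i
... | yes μi≡νi = count≡length [] [] λ j _ →
  trans (cong (λ a → edgesOf μ i j xor does (j ≟ a)) (sym μi≡νi)) (xor-same (edgesOf μ i j))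
... | no  μi≢νi = count≡length ((μi≢νi ∷ []) ∷ [] ∷ []) (at-μ ∷ at-ν ∷ []) elsewhere
  where
  at-μ : does (μ i ≟ μ i) xor does (μ i ≟ ν i) ≡ true
  at-μ rewrite dec-true (μ i ≟ μ i) refl | dec-false (μ i ≟ ν i) μi≢νi = refl
  at-ν : does (ν i ≟ μ i) xor does (ν i ≟ ν i) ≡ true
  at-ν rewrite dec-false (ν i ≟ μ i) (μi≢νi ∘ sym) | dec-true (ν i ≟ ν i) refl = refl
  elsewhere : ∀ j → j ∉ μ i ∷ ν i ∷ [] → does (j ≟ μ i) xor does (j ≟ ν i) ≡ false
  elsewhere j j∉ rewrite dec-false (j ≟ μ i) (j∉ ∘ here) | dec-false (j ≟ ν i) (j∉ ∘ there ∘ here) = refl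

bipEdgeCount-edgesOf-Δ : ∀ {n} (μ ν : Fin n → Fin n) →
                         bipEdgeCount (edgesOf μ Δᵇ edgesOf ν) ≡ 2 * disagreements μ ν
bipEdgeCount-edgesOf-Δ μ ν = trans (∑-cong (count-edgesOf-Δ-row μ ν)) (∑-*ˡ 2 (λ i → ⟦ not (does (μ i ≟ ν i)) ⟧))

adjacent⇒≢ : ∀ {n} {G : Graph n} {a b} → Adj G a b ≡ true → a ≢ b
adjacent⇒≢ {G = G} a~b refl = contradiction (trans (sym a~b) (irrfl G _)) λ ()

record Pairing {n} (G : Graph n) : Set where
  field
    partner    : Fin n → Fin n
    involutive : ∀ i → partner (partner i) ≡ i
    adjacent   : ∀ i → Adj G i (partner i) ≡ true

  partner-injective : ∀ {i j} → partner i ≡ partner j → i ≡ j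
  partner-injective {i} {j} e = trans (sym (involutive i)) (trans (cong partner e) (involutive j))

  no-fixpoint : ∀ i → i ≢ partner i
  no-fixpoint i = adjacent⇒≢ {G = G} (adjacent i)

  asPermutation : Permutation n n
  asPermutation = permutation partner partner involutive involutive

  edges : EdgeSet n
  edges = edgesOf partner

  edges-symmetric : ∀ i j → edges i j ≡ edges j i
  edges-symmetric i j = does-⇔ (mk⇔ (λ { refl → sym (involutive i) }) (λ { refl → sym (involutive j) }))
                               (j ≟ partner i) (i ≟ partner j)

  edges-isPerfectMatching : IsPerfectMatching G edges
  edges-isPerfectMatching = subgraph , edges-symmetric , λ i → count-singleton (partner i)
    where
    subgraph : ∀ i j → edges i j ≡ true → Adj G i j ≡ true
    subgraph i j e = subst (λ k → Adj G i k ≡ true) (sym (edgesOf⇒≡ {μ = partner} e)) (adjacent i)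

record BipPairing {n} (G : BipGraph n) : Set where
  field
    π        : Permutation n n
    adjacent : ∀ i → G i (π ⟨$⟩ʳ i) ≡ true

  partner : Fin n → Fin n
  partner = π ⟨$⟩ʳ_

  partner-injective : ∀ {i j} → partner i ≡ partner j → i ≡ j
  partner-injective e = trans (sym (inverseˡ π)) (trans (cong (π ⟨$⟩ˡ_) e) (inverseˡ π))

  edges : BipEdgeSet n
  edges = edgesOf partner

  edges-isBipPerfectMatching : IsBipPerfectMatching G edges
  edges-isBipPerfectMatching = subgraph , (λ i → count-singleton (partner i)) , columns
    where
    open ≡-Reasoning
    subgraph : ∀ i j → edges i j ≡ true → G i j ≡ true
    subgraph i j e = subst (λ k → G i k ≡ true) (sym (edgesOf⇒≡ {μ = partner} e)) (adjacent i)
    columns : ∀ j → count (λ i → edges i j) ≡ 1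
    columns j = begin
      count (λ i → does (j ≟ partner i)) ≡⟨ ∑-permute (λ k → ⟦ does (j ≟ k) ⟧) π ⟩
      count (λ k → does (j ≟ k))         ≡⟨ count-cong (λ k → does-⇔ (mk⇔ sym sym) (j ≟ k) (k ≟ j)) ⟩
      count (λ k → does (k ≟ j))         ≡⟨ count-singleton j ⟩
      1                                  ∎

open Pairing using (partner; edges)
open BipPairing using () renaming (partner to partnerᵇ; edges to edgesᵇ)

perfectMatching⇒pairing : ∀ {n} {G : Graph n} {M} → IsPerfectMatching G M →
                          Σ[ P ∈ Pairing G ] (∀ i → M i ≗ edges P i)
perfectMatching⇒pairing {n} {G} {M} (subgraph , symmetric , rows) =
  record { partner = μ ; involutive = involutive ; adjacent = λ i → subgraph i (μ i) (M-partner i) } ,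
  λ i → proj₂ (count≡1⇒singleton (rows i))
  where
  μ : Fin n → Fin n
  μ i = proj₁ (count≡1⇒singleton (rows i))
  M-partner : ∀ i → M i (μ i) ≡ true
  M-partner i = trans (proj₂ (count≡1⇒singleton (rows i)) (μ i)) (dec-true (μ i ≟ μ i) refl)
  involutive : ∀ i → μ (μ i) ≡ i
  involutive i = count≡1⇒unique (rows (μ i)) (M-partner (μ i)) (trans (symmetric (μ i) i) (M-partner i))

bipPerfectMatching⇒bipPairing : ∀ {n} {G : BipGraph n} {M} → IsBipPerfectMatching G M →
                                Σ[ B ∈ BipPairing G ] (∀ i → M i ≗ edgesᵇ B i)
bipPerfectMatching⇒bipPairing {n} {G} {M} (subgraph , rows , columns) =
  record { π = permutation μ ν μν≗id νμ≗id ; adjacent = λ i → subgraph i (μ i) (M-row i) } ,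
  λ i → proj₂ (count≡1⇒singleton (rows i))
  where
  μ ν : Fin n → Fin n
  μ i = proj₁ (count≡1⇒singleton (rows i))
  ν j = proj₁ (count≡1⇒singleton (columns j))
  M-row : ∀ i → M i (μ i) ≡ true
  M-row i = trans (proj₂ (count≡1⇒singleton (rows i)) (μ i)) (dec-true (μ i ≟ μ i) refl)
  M-column : ∀ j → M (ν j) j ≡ true
  M-column j = trans (proj₂ (count≡1⇒singleton (columns j)) (ν j)) (dec-true (ν j ≟ ν j) refl)
  μν≗id : ∀ j → μ (ν j) ≡ j
  μν≗id j = count≡1⇒unique (rows (ν j)) (M-row (ν j)) (M-column j)
  νμ≗id : ∀ i → ν (μ i) ≡ i
  νμ≗id i = count≡1⇒unique (columns (μ i)) (M-column (μ i)) (M-row i)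

edgeCount-edgesOf-Δ : ∀ {n} {G : Graph n} (P Q : Pairing G) →
                      edgeCount (edges P Δ edges Q) ≡ disagreements (partner P) (partner Q)
edgeCount-edgesOf-Δ P Q = *-cancelˡ-≡ _ _ 2 (begin
  2 * edgeCount (edges P Δ edges Q)                         ≡⟨ edgeCount-double _ symmetric irreflexive ⟩
  bipEdgeCount (edgesOf (partner P) Δᵇ edgesOf (partner Q)) ≡⟨ bipEdgeCount-edgesOf-Δ (partner P) (partner Q) ⟩
  2 * disagreements (partner P) (partner Q)                 ∎)
  where
  open ≡-Reasoning
  symmetric : ∀ i j → (edges P Δ edges Q) i j ≡ (edges P Δ edges Q) j i
  symmetric i j = cong₂ _xor_ (Pairing.edges-symmetric P i j) (Pairing.edges-symmetric Q i j)
  irreflexive : ∀ i → (edges P Δ edges Q) i i ≡ false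
  irreflexive i = cong₂ _xor_ (dec-false (i ≟ partner P i) (Pairing.no-fixpoint P i))
                              (dec-false (i ≟ partner Q i) (Pairing.no-fixpoint Q i))

-- Two-switches

transpose-matchˡ : ∀ {n} (i j : Fin n) → transpose i j i ≡ j
transpose-matchˡ i j rewrite dec-true (i ≟ i) refl = refl

transpose-matchʳ : ∀ {n} (i j : Fin n) → transpose i j j ≡ i
transpose-matchʳ i j with j ≟ i
... | yes j≡i = j≡i
... | no  _   rewrite dec-true (j ≟ j) refl = refl

transpose-other : ∀ {n} {i j k : Fin n} → k ≢ i → k ≢ j → transpose i j k ≡ k
transpose-other {i = i} {j} {k} k≢i k≢j rewrite dec-false (k ≟ i) k≢i | dec-false (k ≟ j) k≢j = refl

∀-from-All-and-∉ : ∀ {n} {P : Fin n → Set} (l : List (Fin n)) → All P l → (∀ i → i ∉ l → P i) → ∀ i → P i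
∀-from-All-and-∉ l Pl outside i with Any.any? (i ≟_) l
... | yes i∈l = All.lookup Pl i∈l
... | no  i∉l = outside i i∉l

twoSwitch : ∀ {n} {G : Graph n} (P : Pairing G) {u x} → x ≢ partner P u →
            Adj G u x ≡ true → Adj G (partner P u) (partner P x) ≡ true →
            Σ[ Q ∈ Pairing G ] (disagreements (partner P) (partner Q) ≡ 4 × partner Q u ≡ x)
twoSwitch {n} {G} P {u} {x} x≢v u~x v~y =
  Q , count≡length distinct (differ-u ∷ differ-x ∷ differ-v ∷ differ-y ∷ []) agree-elsewhere , ν-u
  where
  open ≡-Reasoning
  open Pairing P using (involutive; adjacent; partner-injective; no-fixpoint)
  μ : Fin n → Fin n
  μ = partner P
  v y : Fin n
  v = μ u
  y = μ x

  -- Conjugating μ by the transposition of v and x pairs u with x and v with y instead.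
  ν : Fin n → Fin n
  ν i = transpose x v (μ (transpose v x i))

  ν-involutive : ∀ i → ν (ν i) ≡ i
  ν-involutive i = begin
    transpose x v (μ (transpose v x (transpose x v (μ (transpose v x i)))))
      ≡⟨ cong (transpose x v ∘ μ) (transpose-inverse v x) ⟩
    transpose x v (μ (μ (transpose v x i)))  ≡⟨ cong (transpose x v) (involutive _) ⟩
    transpose x v (transpose v x i)          ≡⟨ transpose-inverse x v ⟩
    i                                        ∎

  u≢v : u ≢ v
  u≢v = no-fixpoint u
  u≢x : u ≢ x
  u≢x = adjacent⇒≢ {G = G} u~x
  v≢y : v ≢ y
  v≢y = adjacent⇒≢ {G = G} v~y
  x≢y : x ≢ y
  x≢y = no-fixpoint x
  u≢y : u ≢ y
  u≢y u≡y = x≢v (trans (sym (involutive x)) (cong μ (sym u≡y)))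

  ν-u : ν u ≡ x
  ν-u = trans (cong (transpose x v ∘ μ) (transpose-other u≢v u≢x)) (transpose-matchʳ x v)
  ν-x : ν x ≡ u
  ν-x = trans (cong (transpose x v ∘ μ) (transpose-matchʳ v x))
              (trans (cong (transpose x v) (involutive u)) (transpose-other u≢x u≢v))
  ν-v : ν v ≡ y
  ν-v = trans (cong (transpose x v ∘ μ) (transpose-matchˡ v x)) (transpose-other (x≢y ∘ sym) (v≢y ∘ sym))
  ν-y : ν y ≡ v
  ν-y = trans (cong (transpose x v ∘ μ) (transpose-other (v≢y ∘ sym) (x≢y ∘ sym)))
              (trans (cong (transpose x v) (involutive x)) (transpose-matchˡ x v))
  ν-elsewhere : ∀ i → i ∉ u ∷ x ∷ v ∷ y ∷ [] → ν i ≡ μ i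
  ν-elsewhere i i∉ = trans (cong (transpose x v ∘ μ) (transpose-other i≢v i≢x)) (transpose-other μi≢x μi≢v)
    where
    i≢x : i ≢ x
    i≢x = i∉ ∘ there ∘ here
    i≢v : i ≢ v
    i≢v = i∉ ∘ there ∘ there ∘ here
    μi≢x : μ i ≢ x
    μi≢x e = i∉ (there (there (there (here (trans (sym (involutive i)) (cong μ e))))))
    μi≢v : μ i ≢ v
    μi≢v e = i∉ (here (partner-injective e))

  Q : Pairing G
  Q = record
    { partner    = ν
    ; involutive = ν-involutive
    ; adjacent   = ∀-from-All-and-∉ (u ∷ x ∷ v ∷ y ∷ [])
        (ν-adjacent ν-u u~x ∷ ν-adjacent ν-x (trans (Graph.sym G x u) u~x) ∷
         ν-adjacent ν-v v~y ∷ ν-adjacent ν-y (trans (Graph.sym G y v) v~y) ∷ [])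
        (λ i i∉ → ν-adjacent (ν-elsewhere i i∉) (adjacent i))
    }
    where
    ν-adjacent : ∀ {i j} → ν i ≡ j → Adj G i j ≡ true → Adj G i (ν i) ≡ true
    ν-adjacent {i} νi≡j = subst (λ k → Adj G i k ≡ true) (sym νi≡j)

  distinct : Unique (u ∷ x ∷ v ∷ y ∷ [])
  distinct = (u≢x ∷ u≢v ∷ u≢y ∷ []) ∷ (x≢v ∷ x≢y ∷ []) ∷ (v≢y ∷ []) ∷ [] ∷ []

  differ-u : not (does (μ u ≟ ν u)) ≡ true
  differ-u = differs λ e → x≢v (sym (trans e ν-u))
  differ-x : not (does (μ x ≟ ν x)) ≡ true
  differ-x = differs λ e → u≢y (sym (trans e ν-x))
  differ-v : not (does (μ v ≟ ν v)) ≡ true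
  differ-v = differs λ e → u≢y (trans (sym (involutive u)) (trans e ν-v))
  differ-y : not (does (μ y ≟ ν y)) ≡ true
  differ-y = differs λ e → x≢v (trans (sym (involutive x)) (trans e ν-y))
  agree-elsewhere : ∀ i → i ∉ u ∷ x ∷ v ∷ y ∷ [] → not (does (μ i ≟ ν i)) ≡ false
  agree-elsewhere i i∉ = agrees (sym (ν-elsewhere i i∉))

bipTwoSwitch : ∀ {n} {G : BipGraph n} (B : BipPairing G) {u x} → x ≢ u →
               G u (partnerᵇ B x) ≡ true → G x (partnerᵇ B u) ≡ true →
               Σ[ C ∈ BipPairing G ]
                 (disagreements (partnerᵇ B) (partnerᵇ C) ≡ 2 ×
                  partnerᵇ C u ≡ partnerᵇ B x)
bipTwoSwitch {n} {G} B {u} {x} x≢u u~πx x~πu =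
  C , count≡length ((x≢u ∘ sym ∷ []) ∷ [] ∷ []) (differ-u ∷ differ-x ∷ []) agree-elsewhere , ν-u
  where
  open BipPairing B using (π; adjacent; partner-injective) renaming (partner to μ)
  ν : Fin n → Fin n
  ν i = μ (transpose u x i)
  ν-u : ν u ≡ μ x
  ν-u = cong μ (transpose-matchˡ u x)
  ν-x : ν x ≡ μ u
  ν-x = cong μ (transpose-matchʳ u x)
  ν-elsewhere : ∀ i → i ∉ u ∷ x ∷ [] → ν i ≡ μ i
  ν-elsewhere i i∉ = cong μ (transpose-other (i∉ ∘ here) (i∉ ∘ there ∘ here))

  C : BipPairing G
  C = record
    { π        = Perm.transpose u x ∘ₚ π
    ; adjacent = ∀-from-All-and-∉ (u ∷ x ∷ [])
        (ν-adjacent ν-u u~πx ∷ ν-adjacent ν-x x~πu ∷ [])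
        (λ i i∉ → ν-adjacent (ν-elsewhere i i∉) (adjacent i))
    }
    where
    ν-adjacent : ∀ {i j} → ν i ≡ j → G i j ≡ true → G i (ν i) ≡ true
    ν-adjacent {i} νi≡j = subst (λ k → G i k ≡ true) (sym νi≡j)

  differ-u : not (does (μ u ≟ ν u)) ≡ true
  differ-u = differs λ e → x≢u (sym (partner-injective (trans e ν-u)))
  differ-x : not (does (μ x ≟ ν x)) ≡ true
  differ-x = differs λ e → x≢u (partner-injective (trans e ν-x))
  agree-elsewhere : ∀ i → i ∉ u ∷ x ∷ [] → not (does (μ i ≟ ν i)) ≡ false
  agree-elsewhere i i∉ = agrees (sym (ν-elsewhere i i∉))

≤-sum-of-doubles : ∀ {m a b} → m ≤ 2 * a → m ≤ 2 * b → m ≤ a + b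
≤-sum-of-doubles {m} {a} {b} m≤2a m≤2b = *-cancelˡ-≤ 2 (begin
  2 * m       ≡⟨ cong (m +_) (+-identityʳ m) ⟩
  m + m       ≤⟨ +-mono-≤ m≤2a m≤2b ⟩
  2 * a + 2 * b ≡⟨ *-distribˡ-+ 2 a b ⟨
  2 * (a + b) ∎)
  where open ≤-Reasoning

switchablePartner : ∀ {n} {G : Graph n} → (∀ v → n + 2 ≤ 2 * degree G v) → (P : Pairing G) (u : Fin n) →
                    ∃[ x ] (x ≢ partner P u × Adj G u x ≡ true × Adj G (partner P u) (partner P x) ≡ true)
switchablePartner {n} {G} δ≥ P u =
  let x , x≢v , both = 2≤count⇒∃≢ common v in x , x≢v , ∧-true both
  where
  open ≤-Reasoning
  v : Fin n
  v = partner P u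
  common : 2 ≤ count (λ x → Adj G u x ∧ Adj G v (partner P x))
  common = count-∧ (Adj G u) (λ x → Adj G v (partner P x)) (begin
    n + 2                   ≤⟨ ≤-sum-of-doubles {a = degree G u} {b = degree G v} (δ≥ u) (δ≥ v) ⟩
    degree G u + degree G v ≡⟨ cong (degree G u +_) (∑-permute (⟦_⟧ ∘ Adj G v) (Pairing.asPermutation P)) ⟨
    degree G u + count (λ x → Adj G v (partner P x)) ∎)

n+2≤2*[n+3]/2 : ∀ n → n + 2 ≤ 2 * ((n + 3) / 2)
n+2≤2*[n+3]/2 n = +-cancelˡ-≤ 1 (n + 2) (2 * d) (begin
  1 + (n + 2)          ≡⟨ +-comm 1 (n + 2) ⟩
  n + 2 + 1            ≡⟨ +-assoc n 2 1 ⟩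
  n + 3                ≡⟨ m≡m%n+[m/n]*n (n + 3) 2 ⟩
  (n + 3) % 2 + d * 2  ≤⟨ +-mono-≤ (≤-pred (m%n<n (n + 3) 2)) (≤-reflexive (*-comm d 2)) ⟩
  1 + 2 * d            ∎)
  where
  open ≤-Reasoning
  d : ℕ
  d = (n + 3) / 2

bipSwitchablePartner : ∀ {n} {G : BipGraph n} → BipMinDegGE G ((n + 3) / 2) → (B : BipPairing G) (u : Fin n) →
                       ∃[ x ] (x ≢ u × G u (partnerᵇ B x) ≡ true × G x (partnerᵇ B u) ≡ true)
bipSwitchablePartner {n} {G} (rows≥ , columns≥) B u =
  let x , x≢u , both = 2≤count⇒∃≢ common u in x , x≢u , swap (∧-true both)
  where
  open ≤-Reasoning
  μ : Fin n → Fin n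
  μ = partnerᵇ B
  n+2≤2*_ : ∀ {d} → (n + 3) / 2 ≤ d → n + 2 ≤ 2 * d
  n+2≤2*_ d≥ = ≤-trans (n+2≤2*[n+3]/2 n) (*-monoʳ-≤ 2 d≥)
  common : 2 ≤ count (λ x → G x (μ u) ∧ G u (μ x))
  common = count-∧ (λ x → G x (μ u)) (λ x → G u (μ x)) (begin
    n + 2
      ≤⟨ ≤-sum-of-doubles {a = count (λ x → G x (μ u))} (n+2≤2* columns≥ (μ u)) (n+2≤2* rows≥ u) ⟩
    count (λ x → G x (μ u)) + count (G u)
      ≡⟨ cong (count (λ x → G x (μ u)) +_) (∑-permute (⟦_⟧ ∘ G u) (BipPairing.π B)) ⟨
    count (λ x → G x (μ u)) + count (λ x → G u (μ x))
      ∎)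

twoSwitchThrough : ∀ n (G : Graph n) → (∀ v → n + 2 ≤ 2 * degree G v) →
                   (M : EdgeSet n) → IsPerfectMatching G M → (u v : Fin n) → M u v ≡ true →
                   ∃[ M' ] (IsPerfectMatching G M' × edgeCount (M Δ M') ≡ 4 × M' u v ≡ false)
twoSwitchThrough n G δ≥ M pm u v Muv =
  let P , M≗ = perfectMatching⇒pairing {G = G} {M} pm
      x , x≢μu , u~x , μu~μx = switchablePartner δ≥ P u
      Q , four , νu≡x = twoSwitch P x≢μu u~x μu~μx
      v≡μu = edgesOf⇒≡ {μ = partner P} (trans (sym (M≗ u v)) Muv)
  in edges Q ,
     Pairing.edges-isPerfectMatching Q ,
     trans (edgeCount-cong λ a b → cong (_xor edges Q a b) (M≗ a b)) (trans (edgeCount-edgesOf-Δ P Q) four) ,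
     dec-false (v ≟ partner Q u) λ v≡νu → x≢μu (trans (sym νu≡x) (trans (sym v≡νu) v≡μu))

bipTwoSwitchThrough : ∀ n (G : BipGraph n) → BipMinDegGE G ((n + 3) / 2) →
                      (M : BipEdgeSet n) → IsBipPerfectMatching G M → (u v : Fin n) → M u v ≡ true →
                      ∃[ M' ] (IsBipPerfectMatching G M' × bipEdgeCount (M Δᵇ M') ≡ 4 × M' u v ≡ false)
bipTwoSwitchThrough n G δ≥ M pm u v Muv =
  let B , M≗ = bipPerfectMatching⇒bipPairing {G = G} {M} pm
      x , x≢u , u~μx , x~μu = bipSwitchablePartner δ≥ B u
      C , two , νu≡μx = bipTwoSwitch B x≢u u~μx x~μu
      v≡μu = edgesOf⇒≡ {μ = partnerᵇ B} (trans (sym (M≗ u v)) Muv)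
  in edgesᵇ C ,
     BipPairing.edges-isBipPerfectMatching C ,
     trans (bipEdgeCount-cong λ a b → cong (_xor edgesᵇ C a b) (M≗ a b))
           (trans (bipEdgeCount-edgesOf-Δ (partnerᵇ B) (partnerᵇ C)) (cong (2 *_) two)) ,
     dec-false (v ≟ partnerᵇ C u)
       λ v≡νu → x≢u (BipPairing.partner-injective B (trans (sym νu≡μx) (trans (sym v≡νu) v≡μu)))

-- Isolated perfect matchings

-- a, b, μ b, μ a span an alternating 4-cycle unless b = μ a.
NoAlternatingC4 : ∀ {n} {G : Graph n} → Pairing G → Set
NoAlternatingC4 {G = G} P =
  ∀ a b → Adj G a b ≡ true → Adj G (partner P a) (partner P b) ≡ true → b ≡ partner P a

5≤disagreements : ∀ {n} {G : Graph n} (P Q : Pairing G) → NoAlternatingC4 P →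
                  ∀ {x} → partner P x ≢ partner Q x → 5 ≤ disagreements (partner P) (partner Q)
5≤disagreements {G = G} P Q noC4 {x} μx≢νx =
  length≤count distinct (differs μx≢νx ∷ differ-μx ∷ differ-νx ∷ differ-μνx ∷ differ-νμx ∷ [])
  where
  open Pairing P using ()
    renaming (partner to μ; involutive to μμ; partner-injective to μ-injective; no-fixpoint to μ-no-fixpoint)
  open Pairing Q using ()
    renaming (partner to ν; involutive to νν; partner-injective to ν-injective; no-fixpoint to ν-no-fixpoint)

  x≢μx : x ≢ μ x
  x≢μx = μ-no-fixpoint x
  x≢νx : x ≢ ν x
  x≢νx = ν-no-fixpoint x
  x≢μνx : x ≢ μ (ν x)
  x≢μνx e = μx≢νx (trans (cong μ e) (μμ (ν x)))
  x≢νμx : x ≢ ν (μ x)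
  x≢νμx e = μx≢νx (sym (trans (cong ν e) (νν (μ x))))
  μνx≢νμx : μ (ν x) ≢ ν (μ x)
  μνx≢νμx e = μx≢νx (sym (noC4 x (ν x) (Pairing.adjacent Q x)
                                 (subst (λ k → Adj G (μ x) k ≡ true) (sym e) (Pairing.adjacent Q (μ x)))))

  distinct : Unique (x ∷ μ x ∷ ν x ∷ μ (ν x) ∷ ν (μ x) ∷ [])
  distinct = (x≢μx ∷ x≢νx ∷ x≢μνx ∷ x≢νμx ∷ [])
           ∷ (μx≢νx ∷ x≢νx ∘ μ-injective ∷ ν-no-fixpoint (μ x) ∷ [])
           ∷ (μ-no-fixpoint (ν x) ∷ x≢μx ∘ ν-injective ∷ [])
           ∷ (μνx≢νμx ∷ [])
           ∷ [] ∷ []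

  differ-μx : not (does (μ (μ x) ≟ ν (μ x))) ≡ true
  differ-μx = differs λ e → x≢νμx (trans (sym (μμ x)) e)
  differ-νx : not (does (μ (ν x) ≟ ν (ν x))) ≡ true
  differ-νx = differs λ e → x≢μνx (sym (trans e (νν x)))
  differ-μνx : not (does (μ (μ (ν x)) ≟ ν (μ (ν x)))) ≡ true
  differ-μνx = differs λ e → x≢μνx (trans (sym (νν x)) (trans (cong ν (trans (sym (μμ (ν x))) e)) (νν _)))
  differ-νμx : not (does (μ (ν (μ x)) ≟ ν (ν (μ x)))) ≡ true
  differ-νμx = differs λ e → x≢νμx (sym (trans (sym (μμ _)) (trans (cong μ (trans e (νν (μ x)))) (μμ x))))

pairing-isolated : ∀ {n} {G : Graph n} (P : Pairing G) → NoAlternatingC4 P → IsolatedInH2 G (edges P)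
pairing-isolated {G = G} P noC4 = Pairing.edges-isPerfectMatching P , isolated
  where
  isolated : ∀ M' → IsPerfectMatching G M' → Distinct (edges P) M' → 4 < edgeCount (edges P Δ M')
  isolated M' pm' (i , j , differs) = begin-strict
    4                                   <⟨ ≤-refl ⟩
    5                                   ≤⟨ 5≤disagreements P Q noC4 μi≢νi ⟩
    disagreements (partner P) (partner Q) ≡⟨ edgeCount-edgesOf-Δ P Q ⟨
    edgeCount (edges P Δ edges Q)       ≡⟨ edgeCount-cong (λ a b → cong (edges P a b xor_) (M'≗ a b)) ⟨
    edgeCount (edges P Δ M')            ∎
    where
    open ≤-Reasoning
    Q : Pairing G
    Q = proj₁ (perfectMatching⇒pairing {G = G} {M'} pm')
    M'≗ : ∀ a → M' a ≗ edges Q a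
    M'≗ = proj₂ (perfectMatching⇒pairing {G = G} {M'} pm')
    μi≢νi : partner P i ≢ partner Q i
    μi≢νi e = differs (trans (cong (λ k → does (j ≟ k)) e) (sym (M'≗ i j)))

NoAlternatingC4ᵇ : ∀ {n} {G : BipGraph n} → BipPairing G → Set
NoAlternatingC4ᵇ {G = G} B =
  ∀ r s → G r (partnerᵇ B s) ≡ true → G s (partnerᵇ B r) ≡ true → r ≡ s

3≤disagreementsᵇ : ∀ {n} {G : BipGraph n} (B C : BipPairing G) → NoAlternatingC4ᵇ B →
                   ∀ {x} → partnerᵇ B x ≢ partnerᵇ C x →
                   3 ≤ disagreements (partnerᵇ B) (partnerᵇ C)
3≤disagreementsᵇ {n} {G} B C noC4 {x} μx≢νx =
  length≤count distinct (differs μx≢νx ∷ differ-r ∷ differ-s ∷ [])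
  where
  open BipPairing B using () renaming (π to πB; partner to μ; partner-injective to μ-injective)
  open BipPairing C using () renaming (π to πC; partner to ν; partner-injective to ν-injective)
  r s : Fin n
  r = πB ⟨$⟩ˡ ν x
  s = πC ⟨$⟩ˡ μ x
  μr : μ r ≡ ν x
  μr = inverseʳ πB
  νs : ν s ≡ μ x
  νs = inverseʳ πC

  x≢r : x ≢ r
  x≢r e = μx≢νx (trans (cong μ e) μr)
  x≢s : x ≢ s
  x≢s e = μx≢νx (sym (trans (cong ν e) νs))
  r≢s : r ≢ s
  r≢s e = x≢r (noC4 x r (subst (λ k → G x k ≡ true) (sym μr) (BipPairing.adjacent C x))
                        (subst (λ k → G r k ≡ true) (trans (cong ν e) νs) (BipPairing.adjacent C r)))

  distinct : Unique (x ∷ r ∷ s ∷ [])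
  distinct = (x≢r ∷ x≢s ∷ []) ∷ (r≢s ∷ []) ∷ [] ∷ []

  differ-r : not (does (μ r ≟ ν r)) ≡ true
  differ-r = differs λ e → x≢r (ν-injective (trans (sym μr) e))
  differ-s : not (does (μ s ≟ ν s)) ≡ true
  differ-s = differs λ e → x≢s (μ-injective (trans (sym νs) (sym e)))

bipPairing-isolated : ∀ {n} {G : BipGraph n} (B : BipPairing G) → NoAlternatingC4ᵇ B →
                      BipIsolatedInH2 G (edgesᵇ B)
bipPairing-isolated {G = G} B noC4 = BipPairing.edges-isBipPerfectMatching B , isolated
  where
  isolated : ∀ M' → IsBipPerfectMatching G M' → BipDistinct (edgesᵇ B) M' →
             4 < bipEdgeCount (edgesᵇ B Δᵇ M')
  isolated M' pm' (i , j , differs) = begin-strict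
    4                                  <⟨ s≤s (s≤s (s≤s (s≤s (s≤s z≤n)))) ⟩
    2 * 3                              ≤⟨ *-monoʳ-≤ 2 (3≤disagreementsᵇ B C noC4 μi≢νi) ⟩
    2 * disagreements (partnerᵇ B) (partnerᵇ C) ≡⟨ bipEdgeCount-edgesOf-Δ (partnerᵇ B) (partnerᵇ C) ⟨
    bipEdgeCount (edgesᵇ B Δᵇ edgesᵇ C) ≡⟨ bipEdgeCount-cong (λ a b → cong (edgesᵇ B a b xor_) (M'≗ a b)) ⟨
    bipEdgeCount (edgesᵇ B Δᵇ M')       ∎
    where
    open ≤-Reasoning
    C : BipPairing G
    C = proj₁ (bipPerfectMatching⇒bipPairing {G = G} {M'} pm')
    M'≗ : ∀ a → M' a ≗ edgesᵇ C a
    M'≗ = proj₂ (bipPerfectMatching⇒bipPairing {G = G} {M'} pm')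
    μi≢νi : partnerᵇ B i ≢ partnerᵇ C i
    μi≢νi e = differs (trans (cong (λ k → does (j ≟ k)) e) (sym (M'≗ i j)))

-- Alternating Boolean sequences

odd : ℕ → Bool
odd zero    = false
odd (suc n) = not (odd n)

odd-double : ∀ n → odd (n + n) ≡ false
odd-double zero    = refl
odd-double (suc n) = trans (cong (not ∘ odd) (+-suc n n)) (trans (not-involutive _) (odd-double n))

not-both : ∀ {b} → not b ≡ true → b ≡ true → ⊥
not-both {true}  ()
not-both {false} _ ()

Alternating : (ℕ → Bool) → Set
Alternating f = ∀ k → f (suc k) ≡ not (f k)

odd-alternating : Alternating odd
odd-alternating _ = refl

xor-alternating : ∀ {f} c → Alternating f → Alternating (λ k → c xor f k)
xor-alternating {f} c alt k = trans (cong (c xor_) (alt k)) (sym (not-distribʳ-xor c (f k)))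

shift-alternating : ∀ {f} c → Alternating f → Alternating (λ k → f (c + k))
shift-alternating {f} c alt k = trans (cong f (+-suc c k)) (alt (c + k))

∑-toℕ-+ : ∀ a b (f : ℕ → ℕ) →
          ∑ {a + b} (λ k → f (toℕ k)) ≡ ∑ {a} (λ k → f (toℕ k)) + ∑ {b} (λ k → f (a + toℕ k))
∑-toℕ-+ zero    b f = refl
∑-toℕ-+ (suc a) b f = trans (cong (f 0 +_) (∑-toℕ-+ a b (f ∘ suc))) (sym (+-assoc (f 0) _ _))

∑-toℕ-split : ∀ {m n} (f : ℕ → ℕ) → m ≤ n →
              ∑ {n} (λ k → f (toℕ k)) ≡ ∑ {m} (λ k → f (toℕ k)) + ∑ {n ∸ m} (λ k → f (m + toℕ k))
∑-toℕ-split {m} {n} f m≤n =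
  trans (cong (λ l → ∑ {l} (λ k → f (toℕ k))) (sym (m+[n∸m]≡n m≤n))) (∑-toℕ-+ m (n ∸ m) f)

countBelow : (ℕ → Bool) → ℕ → ℕ
countBelow p a = count {a} (λ k → p (toℕ k))

countBelow-alternating : ∀ {p} → Alternating p → ∀ a → 2 * countBelow p a + ⟦ p a ⟧ ≡ a + ⟦ p 0 ⟧
countBelow-alternating alt zero    = refl
countBelow-alternating {p} alt (suc a) = begin
  2 * (⟦ p 0 ⟧ + S) + ⟦ p (suc a) ⟧     ≡⟨ cong (_+ ⟦ p (suc a) ⟧) (*-distribˡ-+ 2 ⟦ p 0 ⟧ S) ⟩
  2 * ⟦ p 0 ⟧ + 2 * S + ⟦ p (suc a) ⟧   ≡⟨ +-assoc (2 * ⟦ p 0 ⟧) (2 * S) _ ⟩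
  2 * ⟦ p 0 ⟧ + (2 * S + ⟦ p (suc a) ⟧) ≡⟨ cong (2 * ⟦ p 0 ⟧ +_) (countBelow-alternating (alt ∘ suc) a) ⟩
  2 * ⟦ p 0 ⟧ + (a + ⟦ p 1 ⟧)           ≡⟨ cong (λ b → 2 * ⟦ p 0 ⟧ + (a + ⟦ b ⟧)) (alt 0) ⟩
  2 * ⟦ p 0 ⟧ + (a + ⟦ not (p 0) ⟧)     ≡⟨ step (p 0) ⟩
  suc a + ⟦ p 0 ⟧                       ∎
  where
  open ≡-Reasoning
  S : ℕ
  S = countBelow (p ∘ suc) a
  step : ∀ b → 2 * ⟦ b ⟧ + (a + ⟦ not b ⟧) ≡ suc a + ⟦ b ⟧
  step true  = cong suc (trans (cong suc (+-identityʳ a)) (+-comm 1 a))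
  step false = trans (+-comm a 1) (sym (+-identityʳ (suc a)))

≤1+2*countBelow : ∀ {p} → Alternating p → ∀ a → a ≤ 1 + 2 * countBelow p a
≤1+2*countBelow {p} alt a = begin
  a                              ≤⟨ m≤m+n a ⟦ p 0 ⟧ ⟩
  a + ⟦ p 0 ⟧                    ≡⟨ countBelow-alternating alt a ⟨
  2 * countBelow p a + ⟦ p a ⟧   ≤⟨ +-monoʳ-≤ (2 * countBelow p a) (⟦⟧≤1 (p a)) ⟩
  2 * countBelow p a + 1         ≡⟨ +-comm (2 * countBelow p a) 1 ⟩
  1 + 2 * countBelow p a         ∎
  where open ≤-Reasoning

≤2*countBelow : ∀ {p} → Alternating p → ∀ a → p 0 ≡ true ⊎ p a ≡ false → a ≤ 2 * countBelow p a
≤2*countBelow {p} alt a (inj₁ p0≡true) = +-cancelʳ-≤ 1 a (2 * countBelow p a) (begin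
  a + 1                          ≡⟨ cong (λ b → a + ⟦ b ⟧) p0≡true ⟨
  a + ⟦ p 0 ⟧                    ≡⟨ countBelow-alternating alt a ⟨
  2 * countBelow p a + ⟦ p a ⟧   ≤⟨ +-monoʳ-≤ (2 * countBelow p a) (⟦⟧≤1 (p a)) ⟩
  2 * countBelow p a + 1         ∎)
  where open ≤-Reasoning
≤2*countBelow {p} alt a (inj₂ pa≡false) = begin
  a                              ≤⟨ m≤m+n a ⟦ p 0 ⟧ ⟩
  a + ⟦ p 0 ⟧                    ≡⟨ countBelow-alternating alt a ⟨
  2 * countBelow p a + ⟦ p a ⟧   ≡⟨ cong (λ b → 2 * countBelow p a + ⟦ b ⟧) pa≡false ⟩
  2 * countBelow p a + 0         ≡⟨ +-identityʳ (2 * countBelow p a) ⟩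
  2 * countBelow p a             ∎
  where open ≤-Reasoning

≤2*countBelow-split : ∀ {m n} (p : ℕ → Bool) → m ≤ n → m ≤ 2 * countBelow p m →
                      n ∸ m ≤ 2 * countBelow (λ k → p (m + k)) (n ∸ m) → n ≤ 2 * countBelow p n
≤2*countBelow-split {m} {n} p m≤n before after = begin
  n                                       ≡⟨ m+[n∸m]≡n m≤n ⟨
  m + (n ∸ m)                             ≤⟨ +-mono-≤ before after ⟩
  2 * countBelow p m + 2 * countBelow pₘ (n ∸ m) ≡⟨ *-distribˡ-+ 2 (countBelow p m) (countBelow pₘ (n ∸ m)) ⟨
  2 * (countBelow p m + countBelow pₘ (n ∸ m))   ≡⟨ cong (2 *_) (∑-toℕ-split (⟦_⟧ ∘ p) m≤n) ⟨
  2 * countBelow p n                      ∎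
  where
  open ≤-Reasoning
  pₘ : ℕ → Bool
  pₘ k = p (m + k)

-- The bipartite example

-- Above the diagonal i ~ j iff i + j is even, below it iff i + j is odd.  Thus i ~ j ~ i
-- forces i = j, and every row and column splits into two alternating runs.
tournament : ℕ → ℕ → Bool
tournament i j = (i ≤ᵇ j) xor odd (i + j)

tournament-below : ∀ {i j} → j < i → tournament i j ≡ odd (i + j)
tournament-below {i} {j} j<i rewrite dec-false (i ≤? j) (<⇒≱ j<i) = refl

tournament-above : ∀ {i j} → i ≤ j → tournament i j ≡ not (odd (i + j))
tournament-above {i} {j} i≤j rewrite dec-true (i ≤? j) i≤j = refl

tournament-refl : ∀ i → tournament i i ≡ true
tournament-refl i = trans (tournament-above {i} ≤-refl) (cong not (odd-double i))

tournament-antisym : ∀ {i j} → tournament i j ≡ true → tournament j i ≡ true → i ≡ j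
tournament-antisym {i} {j} ij ji with <-cmp i j
... | tri< i<j _ _ = ⊥-elim (not-both (trans (sym (tournament-above (<⇒≤ i<j))) ij)
                                      (trans (cong odd (+-comm i j)) (trans (sym (tournament-below i<j)) ji)))
... | tri≈ _ i≡j _ = i≡j
... | tri> _ _ j<i = ⊥-elim (not-both (trans (sym (tournament-above (<⇒≤ j<i))) ji)
                                      (trans (cong odd (+-comm j i)) (trans (sym (tournament-below j<i)) ij)))

tournament-row : ∀ {n} i → i < n → n ≤ 2 * countBelow (tournament i) n
tournament-row {n} i i<n = ≤2*countBelow-split (tournament i) (<⇒≤ i<n) before after
  where
  before : i ≤ 2 * countBelow (tournament i) i
  before = subst (λ c → i ≤ 2 * c) (count-cong {i} λ k → sym (tournament-below (toℕ<n k)))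
             (≤2*countBelow (shift-alternating {odd} i odd-alternating) i (inj₂ (odd-double i)))
  after : n ∸ i ≤ 2 * countBelow (λ k → tournament i (i + k)) (n ∸ i)
  after = subst (λ c → n ∸ i ≤ 2 * c) (count-cong {n ∸ i} λ k → sym (tournament-above (m≤m+n i (toℕ k))))
             (≤2*countBelow alternating (n ∸ i) (inj₁ starts-true))
    where
    alternating : Alternating (λ k → not (odd (i + (i + k))))
    alternating = xor-alternating true (shift-alternating i (shift-alternating {odd} i odd-alternating))
    starts-true : not (odd (i + (i + 0))) ≡ true
    starts-true = trans (cong (λ m → not (odd (i + m))) (+-identityʳ i)) (cong not (odd-double i))

tournament-column : ∀ {n} j → j < n → n ≤ 2 * countBelow (λ i → tournament i j) n
tournament-column {n} j j<n = ≤2*countBelow-split (λ i → tournament i j) j<n before after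
  where
  odd-+j : Alternating (λ k → odd (k + j))
  odd-+j _ = refl
  before : suc j ≤ 2 * countBelow (λ i → tournament i j) (suc j)
  before = subst (λ c → suc j ≤ 2 * c)
             (count-cong {suc j} λ k → sym (tournament-above {toℕ k} (≤-pred (toℕ<n k))))
             (≤2*countBelow (xor-alternating true odd-+j) (suc j) (inj₂ (cong not (cong not (odd-double j)))))
  after : n ∸ suc j ≤ 2 * countBelow (λ k → tournament (suc j + k) j) (n ∸ suc j)
  after = subst (λ c → n ∸ suc j ≤ 2 * c)
            (count-cong {n ∸ suc j} λ k → sym (tournament-below {suc j + toℕ k} (s≤s (m≤m+n j (toℕ k)))))
            (≤2*countBelow (shift-alternating (suc j) odd-+j) (n ∸ suc j)
               (inj₁ (trans (cong (λ m → not (odd (m + j))) (+-identityʳ j)) (cong not (odd-double j)))))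

[n+1]/2≤ : ∀ {n d} → n ≤ 2 * d → (n + 1) / 2 ≤ d
[n+1]/2≤ {n} {d} n≤2d = ≤-pred (m<n*o⇒m/o<n (begin-strict
  n + 1       ≡⟨ +-comm n 1 ⟩
  suc n       <⟨ s≤s (s≤s n≤2d) ⟩
  2 + 2 * d   ≡⟨ cong (2 +_) (*-comm 2 d) ⟩
  suc d * 2   ∎))
  where open ≤-Reasoning

tournamentGraph : ∀ n → BipGraph n
tournamentGraph n i j = tournament (toℕ i) (toℕ j)

tournamentPairing : ∀ n → BipPairing (tournamentGraph n)
tournamentPairing n = record { π = Perm.id ; adjacent = λ i → tournament-refl (toℕ i) }

bipIsolatedExample : ∀ n → ∃[ G ] (BipMinDegGE {n} G ((n + 1) / 2) × ∃[ M ] BipIsolatedInH2 G M)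
bipIsolatedExample n =
  tournamentGraph n ,
  ((λ i → [n+1]/2≤ (tournament-row (toℕ i) (toℕ<n i))) ,
   (λ j → [n+1]/2≤ (tournament-column (toℕ j) (toℕ<n j)))) ,
  edgesᵇ (tournamentPairing n) ,
  bipPairing-isolated (tournamentPairing n) λ r s rs sr → toℕ-injective (tournament-antisym rs sr)

-- The general example

-- (s , σ) is side σ of pair s.  For s < t the edges between the two pairs form a star
-- centred at (t , odd s), so the matching of each pair has no alternating 4-cycle; taking
-- the side of the centre by parity keeps every degree at least q − 1.
pairAdjacent : ℕ × Bool → ℕ × Bool → Bool
pairAdjacent (s , σ) (t , τ) =
  if t <ᵇ s then not σ xor odd t
  else if s <ᵇ t then not τ xor odd s
  else σ xor τ

pairAdjacent-< : ∀ {s t σ τ} → t < s → pairAdjacent (s , σ) (t , τ) ≡ not σ xor odd t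
pairAdjacent-< {s} {t} t<s rewrite dec-true (t <? s) t<s = refl

pairAdjacent-> : ∀ {s t σ τ} → s < t → pairAdjacent (s , σ) (t , τ) ≡ not τ xor odd s
pairAdjacent-> {s} {t} s<t rewrite dec-false (t <? s) (<-asym s<t) | dec-true (s <? t) s<t = refl

pairAdjacent-≡ : ∀ {s σ τ} → pairAdjacent (s , σ) (s , τ) ≡ σ xor τ
pairAdjacent-≡ {s} rewrite dec-false (s <? s) (n≮n s) = refl

pairAdjacent-sym : ∀ X Y → pairAdjacent X Y ≡ pairAdjacent Y X
pairAdjacent-sym (s , σ) (t , τ) with <-cmp s t
... | tri< s<t _ _ = trans (pairAdjacent-> {σ = σ} {τ} s<t) (sym (pairAdjacent-< {σ = τ} {σ} s<t))
... | tri≈ _ refl _ = trans (pairAdjacent-≡ {s} {σ} {τ}) (trans (xor-comm σ τ) (sym (pairAdjacent-≡ {s} {τ} {σ})))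
... | tri> _ _ t<s = trans (pairAdjacent-< {σ = σ} {τ} t<s) (sym (pairAdjacent-> {σ = τ} {σ} t<s))

pairAdjacent-irrefl : ∀ X → pairAdjacent X X ≡ false
pairAdjacent-irrefl (s , σ) = trans (pairAdjacent-≡ {s} {σ}) (xor-same σ)

pairAdjacent-mate : ∀ X → pairAdjacent X (map₂ not X) ≡ true
pairAdjacent-mate (s , σ) = trans (pairAdjacent-≡ {s} {σ}) (xor-not σ)
  where
  xor-not : ∀ b → b xor not b ≡ true
  xor-not true  = refl
  xor-not false = refl

pairAdjacent-noC4 : ∀ X Y → pairAdjacent X Y ≡ true → pairAdjacent (map₂ not X) (map₂ not Y) ≡ true →
                    Y ≡ map₂ not X
pairAdjacent-noC4 (s , σ) (t , τ) XY X'Y' with <-cmp s t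
... | tri< s<t _ _ = ⊥-elim (not-both
  (trans (not-distribˡ-xor (not τ) (odd s)) (trans (sym (pairAdjacent-> {σ = not σ} {not τ} s<t)) X'Y'))
  (trans (sym (pairAdjacent-> {σ = σ} {τ} s<t)) XY))
... | tri≈ _ refl _ = cong (s ,_) (xor-true σ τ (trans (sym (pairAdjacent-≡ {s} {σ})) XY))
  where
  xor-true : ∀ a b → a xor b ≡ true → b ≡ not a
  xor-true true  false _ = refl
  xor-true false true  _ = refl
... | tri> _ _ t<s = ⊥-elim (not-both
  (trans (not-distribˡ-xor (not σ) (odd t)) (trans (sym (pairAdjacent-< {σ = not σ} {not τ} t<s)) X'Y'))
  (trans (sym (pairAdjacent-< {σ = σ} {τ} t<s)) XY))

pairAdjacent-degree : ∀ {q} s σ → s < q →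
  q ≤ 1 + ∑ {q} (λ t → ⟦ pairAdjacent (s , σ) (toℕ t , false) ⟧ + ⟦ pairAdjacent (s , σ) (toℕ t , true) ⟧)
pairAdjacent-degree {q} s σ s<q = begin
  q                     ≡⟨ m+[n∸m]≡n (<⇒≤ s<q) ⟨
  s + (q ∸ s)           ≤⟨ +-monoˡ-≤ (q ∸ s) (≤1+2*countBelow (xor-alternating (not σ) odd-alternating) s) ⟩
  1 + 2 * S + (q ∸ s)   ≡⟨ +-assoc 1 (2 * S) (q ∸ s) ⟩
  1 + (2 * S + (q ∸ s)) ≡⟨ cong suc (cong₂ _+_ below above) ⟨
  1 + (∑ {s} (λ t → h (toℕ t)) + ∑ {q ∸ s} (λ t → h (s + toℕ t)))
                        ≡⟨ cong suc (∑-toℕ-split h (<⇒≤ s<q)) ⟨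
  1 + ∑ {q} (λ t → h (toℕ t)) ∎
  where
  open ≤-Reasoning
  h : ℕ → ℕ
  h t = ⟦ pairAdjacent (s , σ) (t , false) ⟧ + ⟦ pairAdjacent (s , σ) (t , true) ⟧
  S : ℕ
  S = countBelow (λ t → not σ xor odd t) s
  f : Fin s → ℕ
  f t = ⟦ not σ xor odd (toℕ t) ⟧
  below : ∑ {s} (λ t → h (toℕ t)) ≡ 2 * S
  below = begin-equality
    ∑ {s} (λ t → h (toℕ t)) ≡⟨ ∑-cong (λ t → cong₂ _+_ (cong ⟦_⟧ (pairAdjacent-< {s} {σ = σ} {false} (toℕ<n t)))
                                                     (cong ⟦_⟧ (pairAdjacent-< {s} {σ = σ} {true} (toℕ<n t)))) ⟩
    ∑ (λ t → f t + f t)     ≡⟨ ∑-distrib-+ f f ⟩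
    S + S                   ≡⟨ cong (S +_) (+-identityʳ S) ⟨
    2 * S                   ∎
  one-neighbour : ∀ {t} → s ≤ t → h t ≡ 1
  one-neighbour {t} s≤t with m≤n⇒m<n∨m≡n s≤t
  ... | inj₁ s<t rewrite pairAdjacent-> {σ = σ} {false} s<t | pairAdjacent-> {σ = σ} {true} s<t = split (odd s)
    where
    split : ∀ b → ⟦ not b ⟧ + ⟦ b ⟧ ≡ 1
    split true  = refl
    split false = refl
  ... | inj₂ refl rewrite pairAdjacent-≡ {s} {σ} {false} | pairAdjacent-≡ {s} {σ} {true} = split σ
    where
    split : ∀ b → ⟦ b xor false ⟧ + ⟦ b xor true ⟧ ≡ 1
    split true  = refl
    split false = refl
  above : ∑ {q ∸ s} (λ t → h (s + toℕ t)) ≡ q ∸ s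
  above = trans (∑-cong {q ∸ s} (λ t → one-neighbour (m≤m+n s (toℕ t)))) (count-true (q ∸ s))

pairOf : ∀ q → Fin (q * 2) → ℕ × Bool
pairOf (suc q) zero          = 0 , false
pairOf (suc q) (suc zero)    = 0 , true
pairOf (suc q) (suc (suc i)) = map₁ suc (pairOf q i)

pairOf-< : ∀ q i → proj₁ (pairOf q i) < q
pairOf-< (suc q) zero          = s≤s z≤n
pairOf-< (suc q) (suc zero)    = s≤s z≤n
pairOf-< (suc q) (suc (suc i)) = s≤s (pairOf-< q i)

pairOf-injective : ∀ q {i j} → pairOf q i ≡ pairOf q j → i ≡ j
pairOf-injective (suc q) {zero}        {zero}        _  = refl
pairOf-injective (suc q) {zero}        {suc zero}    ()
pairOf-injective (suc q) {zero}        {suc (suc j)} ()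
pairOf-injective (suc q) {suc zero}    {zero}        ()
pairOf-injective (suc q) {suc zero}    {suc zero}    _  = refl
pairOf-injective (suc q) {suc zero}    {suc (suc j)} ()
pairOf-injective (suc q) {suc (suc i)} {zero}        ()
pairOf-injective (suc q) {suc (suc i)} {suc zero}    ()
pairOf-injective (suc q) {suc (suc i)} {suc (suc j)} e = cong (λ k → suc (suc k)) (pairOf-injective q (cong (map₁ pred) e))

∑-pairOf : ∀ q (F : ℕ × Bool → ℕ) →
           ∑ {q * 2} (λ i → F (pairOf q i)) ≡ ∑ {q} (λ t → F (toℕ t , false) + F (toℕ t , true))
∑-pairOf zero    F = refl
∑-pairOf (suc q) F = trans (cong (λ S → F (0 , false) + (F (0 , true) + S)) (∑-pairOf q (F ∘ map₁ suc)))
                           (sym (+-assoc (F (0 , false)) _ _))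

mate : ∀ q → Fin (q * 2) → Fin (q * 2)
mate (suc q) zero          = suc zero
mate (suc q) (suc zero)    = zero
mate (suc q) (suc (suc i)) = suc (suc (mate q i))

mate-involutive : ∀ q i → mate q (mate q i) ≡ i
mate-involutive (suc q) zero          = refl
mate-involutive (suc q) (suc zero)    = refl
mate-involutive (suc q) (suc (suc i)) = cong (λ k → suc (suc k)) (mate-involutive q i)

pairOf-mate : ∀ q i → pairOf q (mate q i) ≡ map₂ not (pairOf q i)
pairOf-mate (suc q) zero          = refl
pairOf-mate (suc q) (suc zero)    = refl
pairOf-mate (suc q) (suc (suc i)) = cong (map₁ suc) (pairOf-mate q i)

pairGraph : ∀ q → Graph (q * 2)
pairGraph q = record
  { Adj   = λ i j → pairAdjacent (pairOf q i) (pairOf q j)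
  ; sym   = λ i j → pairAdjacent-sym (pairOf q i) (pairOf q j)
  ; irrfl = λ i → pairAdjacent-irrefl (pairOf q i)
  }

pairGraph-degree : ∀ q v → q * 2 ≤ 2 * degree (pairGraph q) v + 4
pairGraph-degree q v = begin
  q * 2         ≤⟨ *-monoˡ-≤ 2 q≤1+d ⟩
  2 + d * 2     ≡⟨ +-comm 2 (d * 2) ⟩
  d * 2 + 2     ≤⟨ +-monoʳ-≤ (d * 2) (s≤s (s≤s z≤n)) ⟩
  d * 2 + 4     ≡⟨ cong (_+ 4) (*-comm d 2) ⟩
  2 * d + 4     ∎
  where
  open ≤-Reasoning
  X : ℕ × Bool
  X = pairOf q v
  d : ℕ
  d = degree (pairGraph q) v
  q≤1+d : q ≤ 1 + d
  q≤1+d = subst (λ S → q ≤ 1 + S) (sym (∑-pairOf q (⟦_⟧ ∘ pairAdjacent X)))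
                (pairAdjacent-degree (proj₁ X) (proj₂ X) (pairOf-< q v))

pairPairing : ∀ q → Pairing (pairGraph q)
pairPairing q = record
  { partner    = mate q
  ; involutive = mate-involutive q
  ; adjacent   = λ i → subst (λ Y → pairAdjacent (pairOf q i) Y ≡ true) (sym (pairOf-mate q i))
                               (pairAdjacent-mate (pairOf q i))
  }

pairPairing-noAlternatingC4 : ∀ q → NoAlternatingC4 (pairPairing q)
pairPairing-noAlternatingC4 q a b ab a'b' = pairOf-injective q (trans
  (pairAdjacent-noC4 (pairOf q a) (pairOf q b) ab
     (subst₂ (λ X Y → pairAdjacent X Y ≡ true) (pairOf-mate q a) (pairOf-mate q b) a'b'))
  (sym (pairOf-mate q a)))

isolatedExample : ∀ n → 2 ∣ n → ∃[ G ] ((∀ v → n ≤ 2 * degree G v + 4) × ∃[ M ] IsolatedInH2 {n} G M)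
isolatedExample .(q * 2) (divides q refl) =
  pairGraph q , pairGraph-degree q , Pairing.edges (pairPairing q) ,
  pairing-isolated (pairPairing q) (pairPairing-noAlternatingC4 q)

theorem6p3 :
  -- (a) general graphs: δ(G) ≥ n/2 + 1, i.e. n + 2 ≤ 2 δ(G)
  ((n : ℕ) (G : Graph n) → (∀ v → n + 2 ≤ 2 * degree G v) →
    (M : EdgeSet n) → IsPerfectMatching G M →
    (u v : Fin n) → M u v ≡ true →
    ∃[ M' ] (IsPerfectMatching G M' × edgeCount (M Δ M') ≡ 4 × M' u v ≡ false))
  ×
  -- (a) balanced bipartite graphs: δ(G) ≥ ⌊(n+3)/2⌋
  ((n : ℕ) (G : BipGraph n) → BipMinDegGE G ((n + 3) / 2) →
    (M : BipEdgeSet n) → IsBipPerfectMatching G M →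
    (u v : Fin n) → M u v ≡ true →
    ∃[ M' ] (IsBipPerfectMatching G M' × bipEdgeCount (M Δᵇ M') ≡ 4 × M' u v ≡ false))
  ×
  -- (b) even n: a graph with δ(G) ≥ n/2 − 2 (i.e. n ≤ 2 δ(G) + 4) whose H₂ has an isolated vertex
  ((n : ℕ) → 2 ∣ n →
    ∃[ G ] ((∀ v → n ≤ 2 * degree G v + 4) × ∃[ M ] IsolatedInH2 {n} G M))
  ×
  -- (b) bipartite: δ(G) ≥ ⌊(n+1)/2⌋ with an isolated vertex in H₂
  ((n : ℕ) →
    ∃[ G ] (BipMinDegGE {n} G ((n + 1) / 2) × ∃[ M ] BipIsolatedInH2 G M))
theorem6p3 = twoSwitchThrough , bipTwoSwitchThrough , isolatedExample , bipIsolatedExample
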